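{- Let $n\ge0$ and $0\le m\le 2^n-1$, and write $\{m\}_n=1^{k_0}0^{k_1}\cdots 0^{k_{l-2}}1^{k_{l-1}}$ with $l$ odd, $k_0\ge0$, $k_i\ge1$ ($i=1,\dots,l-2$), $k_{l-1}\ge 0$. If $l\ge 3$, then (1) $[2^n:m]=[k_0,k_1,\dots,k_{l-1}]$; (2) $[2^n:2^n-m]=[k_1,k_2,\dots,k_{l-1}]$; (3) $[2^n:m+1]=[k_0,k_1,\dots,k_{l-2}]$; (4) $[2^n:2^n-(m+1)]=[k_1,k_2,\dots,k_{l-2}]$. If $l=1$, then $n=k_0$, $m=2^n-1$, and $[2^n:m]=n$, $[2^n:2^n-m]=1$, $[2^n:m+1]=1$, $[2^n:2^n-(m+1)]=0$.
   Context: Stern's diatomic integers: for integers $n\ge0$, $0\le m\le 2^n$, define $[2^0:0]=0$, $[2^0:1]=1$, $[2^{n+1}:2m]=[2^n:m]$ ($0\le m\le 2^n$), $[2^{n+1}:2m+1]=[2^n:m]+[2^n:m+1]$ ($0\le m\le 2^n-1$). For $0\le m\le 2^n-1$, $\{m\}_n$ is the binary word of length $n$ (leading zeros allowed) representing $m$ in base 2; $x^k$ denotes $k$ copies of the letter $x$. Continuant: $[x_0]=x_0$, $[x_0,x_1]=x_0x_1+1$, $[x_0,\dots,x_{l-1}]=[x_0,\dots,x_{l-2}]x_{l-1}+[x_0,\dots,x_{l-3}]$ for $l\ge3$, and $[\,]=1$ for the empty sequence. -}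

module Defs where

open import Data.Nat using (ℕ; zero; suc; _+_; _*_; _/_; _%_; _≡ᵇ_)
open import Data.Bool using (Bool; true; false; not; if_then_else_)
open import Data.List using (List; []; _∷_; _++_; _∷ʳ_; replicate; reverse)

-- Stern's diatomic integers [2^n : m], by recursion on n.
-- Values outside the range 0 ≤ m ≤ 2^n are junk (never used).
stern : ℕ → ℕ → ℕ
stern zero zero = 0
stern zero (suc zero) = 1
stern zero (suc (suc _)) = 0
stern (suc n) m =
  if m % 2 ≡ᵇ 0
  then stern n (m / 2)
  else stern n (m / 2) + stern n (suc (m / 2))

-- {m}_n : the binary word of length n representing m (most significant bit
-- first, leading zeros allowed); true = letter 1, false = letter 0.
binWord : ℕ → ℕ → List Bool
binWord zero m = []
binWord (suc n) m = binWord n (m / 2) ∷ʳ (m % 2 ≡ᵇ 1)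

runs : Bool → List ℕ → List Bool
runs b [] = []
runs b (k ∷ ks) = replicate k b ++ runs (not b) ks

-- continuant, following the recursion on the last entry:
-- contRev takes the sequence in reversed order (last entry first).
contRev : List ℕ → ℕ
contRev [] = 1
contRev (x ∷ []) = x
contRev (x ∷ y ∷ rest) = contRev (y ∷ rest) * x + contRev rest

cont : List ℕ → ℕ
cont xs = contRev (reverse xs)

-- Reading the bits of {m}_n from left to right, starting from (0, 1), with
-- 0 : (a , b) ↦ (a , a + b) and 1 : (a , b) ↦ (a + b , b), produces the
-- consecutive pair ([2^n : m] , [2^n : m + 1]), because the recursion of
-- Stern's sequence halves m. A run of k equal letters acts on such a pair as
-- the continuant recursion with entry k, so the run lengths of {m}_n turn into
-- continuants. The word of 2^n - 1 - m is the complement of {m}_n, and reading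
-- a complemented word from (0, 1) is reading the word itself from (1, 0) with
-- the coordinates swapped; from (1, 0) the leading run of 1s has no effect,
-- which is why k₀ disappears in parts (2) and (4).
module Submission where

open import Defs
open import Data.Nat using (ℕ; zero; suc; _+_; _*_; _≤_; _<_; _^_; _∸_; _%_; s≤s)
open import Data.Nat.Properties
  using (*-comm; *-identityˡ; *-zeroʳ; *-cancelˡ-≡; *-cancelʳ-<; +-comm; +-identityʳ; +-∸-assoc;
         m≤n+m; m+[n∸m]≡n; n<1⇒n≡0; 0≢1+n; module ≤-Reasoning)
open import Data.Nat.DivMod using (_/_; m*n%n≡0; m*n/n≡m; [m+kn]%n≡m%n; +-distrib-/-∣ʳ)
open import Data.Nat.Divisibility using (divides)
open import Data.Nat.Tactic.RingSolver using (solve)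
open import Data.Bool using (Bool; true; false; not)
open import Data.Bool.Properties using (not-involutive)
open import Data.List
  using (List; []; _∷_; _++_; _∷ʳ_; [_]; _ʳ++_; length; map; foldl; replicate; reverse)
open import Data.List.Properties
  using (foldl-++; foldl-∷ʳ; map-++; map-replicate; reverse-++; ∷ʳ-injective;
         length-++; length-replicate; ++-identityʳ)
open import Data.List.Relation.Unary.All using (All)
open import Data.Product using (_×_; _,_; proj₁; proj₂; swap; ∃)
open import Data.Empty using (⊥-elim)
open import Function using (_$_; _∘′_)
open import Relation.Binary.PropositionalEquality
  using (_≡_; _≢_; refl; sym; trans; cong; subst; module ≡-Reasoning)

bitValue : Bool → ℕ
bitValue false = 0
bitValue true  = 1

data Halving : ℕ → Set where
  halving : ∀ b q → Halving (bitValue b + q * 2)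

halve : ∀ m → Halving m
halve zero = halving false 0
halve (suc m) with halve m
... | halving false q = halving true q
... | halving true  q = halving false (suc q)

halving-< : ∀ b q N → bitValue b + q * 2 < 2 * N → q < N
halving-< b q N lt = *-cancelʳ-< 2 q N $ begin-strict
  q * 2              ≤⟨ m≤n+m (q * 2) (bitValue b) ⟩
  bitValue b + q * 2 <⟨ lt ⟩
  2 * N              ≡⟨ *-comm 2 N ⟩
  N * 2              ∎
  where open ≤-Reasoning

even-%2 : ∀ q → q * 2 % 2 ≡ 0
even-%2 q = m*n%n≡0 q 2

odd-%2 : ∀ q → suc (q * 2) % 2 ≡ 1
odd-%2 q = [m+kn]%n≡m%n 1 q 2

even-/2 : ∀ q → q * 2 / 2 ≡ q
even-/2 q = m*n/n≡m q 2

odd-/2 : ∀ q → suc (q * 2) / 2 ≡ q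
odd-/2 q = trans (+-distrib-/-∣ʳ 1 {d = 2} (divides q refl)) (m*n/n≡m q 2)

even≢odd : ∀ p q → 2 * p ≢ suc (q * 2)
even≢odd p q eq = 0≢1+n $ begin
  0                   ≡⟨ even-%2 p ⟨
  (p * 2) % 2         ≡⟨ cong (_% 2) (trans (*-comm p 2) eq) ⟩
  suc (q * 2) % 2     ≡⟨ odd-%2 q ⟩
  1                   ∎
  where open ≡-Reasoning

complement-halving : ∀ b q D N → suc (bitValue b + q * 2 + D) ≡ 2 * N →
                     ∃ λ D′ → D ≡ bitValue (not b) + D′ * 2 × suc (q + D′) ≡ N
complement-halving b q D N eq with halve D
complement-halving false q _ N eq | halving false D′ = ⊥-elim $ even≢odd N (q + D′) $ begin
  2 * N                  ≡⟨ eq ⟨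
  suc (q * 2 + D′ * 2)   ≡⟨ solve (q ∷ D′ ∷ []) ⟩
  suc ((q + D′) * 2)     ∎
  where open ≡-Reasoning
complement-halving false q _ N eq | halving true D′ = D′ , refl , *-cancelˡ-≡ _ N 2 (begin
  2 * suc (q + D′)             ≡⟨ solve (q ∷ D′ ∷ []) ⟩
  suc (q * 2 + suc (D′ * 2))   ≡⟨ eq ⟩
  2 * N                        ∎)
  where open ≡-Reasoning
complement-halving true q _ N eq | halving false D′ = D′ , refl , *-cancelˡ-≡ _ N 2 (begin
  2 * suc (q + D′)             ≡⟨ solve (q ∷ D′ ∷ []) ⟩
  suc (suc (q * 2) + D′ * 2)   ≡⟨ eq ⟩
  2 * N                        ∎)
  where open ≡-Reasoning
complement-halving true q _ N eq | halving true D′ = ⊥-elim $ even≢odd N (suc (q + D′)) $ begin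
  2 * N                              ≡⟨ eq ⟨
  suc (suc (q * 2) + suc (D′ * 2))   ≡⟨ solve (q ∷ D′ ∷ []) ⟩
  suc (suc (q + D′) * 2)             ∎
  where open ≡-Reasoning

binWord-halving : ∀ n b q → binWord (suc n) (bitValue b + q * 2) ≡ binWord n q ∷ʳ b
binWord-halving n false q rewrite even-%2 q | even-/2 q = refl
binWord-halving n true  q rewrite odd-%2 q | odd-/2 q = refl

length-binWord : ∀ n m → length (binWord n m) ≡ n
length-binWord zero m = refl
length-binWord (suc n) m =
  trans (length-++ (binWord n (m / 2))) (trans (+-comm _ 1) (cong suc (length-binWord n (m / 2))))

complement-< : ∀ {m D N} → suc (m + D) ≡ N → D < N
complement-< {m} {D} eq = subst (D <_) eq (s≤s (m≤n+m D m))

binWord-complement : ∀ n m D → suc (m + D) ≡ 2 ^ n → binWord n D ≡ map not (binWord n m)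
binWord-complement zero m D eq = refl
binWord-complement (suc n) m D eq with halve m
... | halving b q with complement-halving b q D (2 ^ n) eq
... | D′ , refl , eq′ = begin
  binWord (suc n) (bitValue (not b) + D′ * 2)   ≡⟨ binWord-halving n (not b) D′ ⟩
  binWord n D′ ∷ʳ not b                         ≡⟨ cong (_∷ʳ not b) (binWord-complement n q D′ eq′) ⟩
  map not (binWord n q) ∷ʳ not b                ≡⟨ map-++ not (binWord n q) [ b ] ⟨
  map not (binWord n q ∷ʳ b)                    ≡⟨ cong (map not) (binWord-halving n b q) ⟨
  map not (binWord (suc n) (bitValue b + q * 2)) ∎
  where open ≡-Reasoning

replicate-∷ʳ : ∀ {A : Set} n (x : A) → replicate (suc n) x ≡ replicate n x ∷ʳ x
replicate-∷ʳ zero    x = refl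
replicate-∷ʳ (suc n) x = cong (x ∷_) (replicate-∷ʳ n x)

binWord≡replicate-false⇒≡0 : ∀ n m → m < 2 ^ n → binWord n m ≡ replicate n false → m ≡ 0
binWord≡replicate-false⇒≡0 zero m lt _ = n<1⇒n≡0 lt
binWord≡replicate-false⇒≡0 (suc n) m lt w with halve m
... | halving b q with ∷ʳ-injective (binWord n q) (replicate n false)
                         (trans (sym (binWord-halving n b q)) (trans w (replicate-∷ʳ n false)))
... | w′ , refl rewrite binWord≡replicate-false⇒≡0 n q (halving-< false q (2 ^ n) lt) w′ = refl

pushBit : ℕ × ℕ → Bool → ℕ × ℕ
pushBit (a , b) false = a , a + b
pushBit (a , b) true  = a + b , b

sternPair : ℕ → ℕ → ℕ × ℕ
sternPair n m = stern n m , stern n (suc m)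

sternPair-halving : ∀ n b q → sternPair (suc n) (bitValue b + q * 2) ≡ pushBit (sternPair n q) b
sternPair-halving n false q
  rewrite even-%2 q | even-/2 q | odd-%2 q | odd-/2 q = refl
sternPair-halving n true q
  rewrite odd-%2 q | odd-/2 q | even-%2 (suc q) | even-/2 (suc q) = refl

sternPair≡foldl-pushBit : ∀ n m → m < 2 ^ n → sternPair n m ≡ foldl pushBit (0 , 1) (binWord n m)
sternPair≡foldl-pushBit zero zero _ = refl
sternPair≡foldl-pushBit zero (suc m) (s≤s ())
sternPair≡foldl-pushBit (suc n) m lt with halve m
... | halving b q = begin
  sternPair (suc n) (bitValue b + q * 2)           ≡⟨ sternPair-halving n b q ⟩
  pushBit (sternPair n q) b                        ≡⟨ cong (λ p → pushBit p b) ih ⟩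
  pushBit (foldl pushBit (0 , 1) (binWord n q)) b  ≡⟨ foldl-∷ʳ pushBit (0 , 1) b (binWord n q) ⟨
  foldl pushBit (0 , 1) (binWord n q ∷ʳ b)         ≡⟨ cong (foldl pushBit (0 , 1)) (binWord-halving n b q) ⟨
  foldl pushBit (0 , 1) (binWord (suc n) (bitValue b + q * 2)) ∎
  where
  open ≡-Reasoning
  ih : sternPair n q ≡ foldl pushBit (0 , 1) (binWord n q)
  ih = sternPair≡foldl-pushBit n q (halving-< b q (2 ^ n) lt)

swap-pushBit : ∀ s b → swap (pushBit s (not b)) ≡ pushBit (swap s) b
swap-pushBit (a , c) false = cong (c ,_) (+-comm a c)
swap-pushBit (a , c) true  = cong (_, a) (+-comm a c)

foldl-pushBit-map-not : ∀ s w → foldl pushBit s (map not w) ≡ swap (foldl pushBit (swap s) w)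
foldl-pushBit-map-not s []      = refl
foldl-pushBit-map-not s (b ∷ w) =
  trans (foldl-pushBit-map-not (pushBit s (not b)) w)
        (cong (λ t → swap (foldl pushBit t w)) (swap-pushBit s b))

stern-complement : ∀ n m → m < 2 ^ n →
  (stern n (2 ^ n ∸ m) , stern n (2 ^ n ∸ suc m)) ≡ foldl pushBit (1 , 0) (binWord n m)
stern-complement n m lt = begin
  (stern n (2 ^ n ∸ m) , stern n D)              ≡⟨ cong (λ x → stern n x , stern n D) (+-∸-assoc 1 lt) ⟩
  swap (sternPair n D)                           ≡⟨ cong swap (sternPair≡foldl-pushBit n D (complement-< eq)) ⟩
  swap (foldl pushBit (0 , 1) (binWord n D))     ≡⟨ cong (swap ∘′ foldl pushBit (0 , 1)) (binWord-complement n m D eq) ⟩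
  swap (foldl pushBit (0 , 1) (map not (binWord n m))) ≡⟨ cong swap (foldl-pushBit-map-not (0 , 1) (binWord n m)) ⟩
  foldl pushBit (1 , 0) (binWord n m)            ∎
  where
  open ≡-Reasoning
  D : ℕ
  D = 2 ^ n ∸ suc m
  eq : suc (m + D) ≡ 2 ^ n
  eq = m+[n∸m]≡n lt

-- contPair (x ∷ rs) = ([reverse (x ∷ rs)] , [reverse rs]); the value (1 , 0)
-- on [] continues the continuant recursion one step backwards.
contPair : List ℕ → ℕ × ℕ
contPair []       = 1 , 0
contPair (x ∷ rs) = contRev (x ∷ rs) , contRev rs

appendEntry : ℕ → ℕ × ℕ → ℕ × ℕ
appendEntry k (P , Q) = P * k + Q , P

contPair-∷ : ∀ x rs → contPair (x ∷ rs) ≡ appendEntry x (contPair rs)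
contPair-∷ x []      = cong (_, 1) (sym (trans (+-identityʳ (1 * x)) (*-identityˡ x)))
contPair-∷ x (_ ∷ _) = refl

orient : Bool → ℕ × ℕ → ℕ × ℕ
orient true  p = p
orient false p = swap p

foldl-pushBit-run : ∀ b k p →
  foldl pushBit (orient b p) (replicate k (not b)) ≡ orient (not b) (appendEntry k p)
foldl-pushBit-run true  zero    (P , Q) rewrite *-zeroʳ P = refl
foldl-pushBit-run false zero    (P , Q) rewrite *-zeroʳ P = refl
foldl-pushBit-run true  (suc k) (P , Q) = trans (foldl-pushBit-run true k (P , P + Q)) (cong (P ,_) arith)
  where
  arith : P * k + (P + Q) ≡ P * suc k + Q
  arith = solve (P ∷ Q ∷ k ∷ [])
foldl-pushBit-run false (suc k) (P , Q) = trans (foldl-pushBit-run false k (P , Q + P)) (cong (_, P) arith)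
  where
  arith : P * k + (Q + P) ≡ P * suc k + Q
  arith = solve (P ∷ Q ∷ k ∷ [])

-- alternate b ks is the letter of the last run of runs (not b) ks.
alternate : Bool → List ℕ → Bool
alternate = foldl (λ b _ → not b)

alternate-odd : ∀ b xs → length xs % 2 ≡ 1 → alternate b xs ≡ not b
alternate-odd b (_ ∷ [])     _   = refl
alternate-odd b (_ ∷ _ ∷ xs) odd rewrite not-involutive b = alternate-odd b xs odd

alternate-odd-∷ʳ : ∀ b xs x → length xs % 2 ≡ 1 → alternate b (xs ∷ʳ x) ≡ b
alternate-odd-∷ʳ b xs x odd = begin
  alternate b (xs ∷ʳ x)  ≡⟨ foldl-∷ʳ _ b x xs ⟩
  not (alternate b xs)   ≡⟨ cong not (alternate-odd b xs odd) ⟩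
  not (not b)            ≡⟨ not-involutive b ⟩
  b                      ∎
  where open ≡-Reasoning

foldl-pushBit-runs : ∀ b ks rs →
  foldl pushBit (orient b (contPair rs)) (runs (not b) ks) ≡ orient (alternate b ks) (contPair (ks ʳ++ rs))
foldl-pushBit-runs b []       rs = refl
foldl-pushBit-runs b (k ∷ ks) rs = begin
  foldl pushBit (orient b (contPair rs)) (replicate k (not b) ++ runs (not (not b)) ks)
    ≡⟨ foldl-++ pushBit _ (replicate k (not b)) _ ⟩
  foldl pushBit (foldl pushBit (orient b (contPair rs)) (replicate k (not b))) (runs (not (not b)) ks)
    ≡⟨ cong (λ s → foldl pushBit s (runs (not (not b)) ks)) (foldl-pushBit-run b k (contPair rs)) ⟩
  foldl pushBit (orient (not b) (appendEntry k (contPair rs))) (runs (not (not b)) ks)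
    ≡⟨ cong (λ p → foldl pushBit (orient (not b) p) (runs (not (not b)) ks)) (contPair-∷ k rs) ⟨
  foldl pushBit (orient (not b) (contPair (k ∷ rs))) (runs (not (not b)) ks)
    ≡⟨ foldl-pushBit-runs (not b) ks (k ∷ rs) ⟩
  orient (alternate (not b) ks) (contPair (ks ʳ++ k ∷ rs))
    ∎
  where open ≡-Reasoning

foldl-pushBit-runs-from-10 : ∀ k₀ ks →
  foldl pushBit (1 , 0) (runs true (k₀ ∷ ks)) ≡ orient (alternate true ks) (contPair (reverse ks))
foldl-pushBit-runs-from-10 k₀ ks = begin
  foldl pushBit (1 , 0) (replicate k₀ true ++ runs false ks)
    ≡⟨ foldl-++ pushBit (1 , 0) (replicate k₀ true) (runs false ks) ⟩
  foldl pushBit (foldl pushBit (1 , 0) (replicate k₀ true)) (runs false ks)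
    ≡⟨ cong (λ s → foldl pushBit s (runs false ks)) (foldl-pushBit-run false k₀ (0 , 1)) ⟩
  foldl pushBit (1 , 0) (runs false ks)
    ≡⟨ foldl-pushBit-runs true ks [] ⟩
  orient (alternate true ks) (contPair (reverse ks))
    ∎
  where open ≡-Reasoning

contPair-reverse-∷ʳ : ∀ xs x → contPair (reverse (xs ∷ʳ x)) ≡ (cont (xs ∷ʳ x) , cont xs)
contPair-reverse-∷ʳ xs x = trans (cong contPair rev) (cong (_, cont xs) (cong contRev (sym rev)))
  where
  rev : reverse (xs ∷ʳ x) ≡ x ∷ reverse xs
  rev = reverse-++ xs [ x ]

stern-continuants : ∀ n m → m < 2 ^ n → ∀ k₀ ks →
  binWord n m ≡ runs true (k₀ ∷ ks) → alternate true ks ≡ true →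
  sternPair n m ≡ contPair (reverse (k₀ ∷ ks))
  × (stern n (2 ^ n ∸ m) , stern n (2 ^ n ∸ suc m)) ≡ contPair (reverse ks)
stern-continuants n m lt k₀ ks w last =
  (begin
    sternPair n m                                ≡⟨ sternPair≡foldl-pushBit n m lt ⟩
    foldl pushBit (0 , 1) (binWord n m)          ≡⟨ cong (foldl pushBit (0 , 1)) w ⟩
    foldl pushBit (0 , 1) (runs true (k₀ ∷ ks))  ≡⟨ foldl-pushBit-runs false (k₀ ∷ ks) [] ⟩
    orient (alternate true ks) (contPair (reverse (k₀ ∷ ks)))
                                                 ≡⟨ cong (λ b → orient b (contPair (reverse (k₀ ∷ ks)))) last ⟩
    contPair (reverse (k₀ ∷ ks))                 ∎) ,
  (begin
    (stern n (2 ^ n ∸ m) , stern n (2 ^ n ∸ suc m)) ≡⟨ stern-complement n m lt ⟩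
    foldl pushBit (1 , 0) (binWord n m)             ≡⟨ cong (foldl pushBit (1 , 0)) w ⟩
    foldl pushBit (1 , 0) (runs true (k₀ ∷ ks))     ≡⟨ foldl-pushBit-runs-from-10 k₀ ks ⟩
    orient (alternate true ks) (contPair (reverse ks)) ≡⟨ cong (λ b → orient b (contPair (reverse ks))) last ⟩
    contPair (reverse ks)                           ∎)
  where open ≡-Reasoning

binWord≡replicate-true⇒≡2ⁿ∸1 : ∀ n m → m < 2 ^ n → binWord n m ≡ replicate n true → m ≡ 2 ^ n ∸ 1
binWord≡replicate-true⇒≡2ⁿ∸1 n m lt w = begin
  m          ≡⟨ +-identityʳ m ⟨
  m + 0      ≡⟨ cong (m +_) D≡0 ⟨
  m + D      ≡⟨ cong (_∸ 1) eq ⟩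
  2 ^ n ∸ 1  ∎
  where
  open ≡-Reasoning
  D : ℕ
  D = 2 ^ n ∸ suc m
  eq : suc (m + D) ≡ 2 ^ n
  eq = m+[n∸m]≡n lt
  D≡0 : D ≡ 0
  D≡0 = binWord≡replicate-false⇒≡0 n D (complement-< eq)
          (trans (binWord-complement n m D eq) (trans (cong (map not) w) (map-replicate not n true)))

theorem4p4 :
    (∀ (n m : ℕ) → m < 2 ^ n →
      ∀ (k₀ : ℕ) (mid : List ℕ) (kₗ : ℕ) →
      length mid % 2 ≡ 1 → All (1 ≤_) mid →
      binWord n m ≡ runs true (k₀ ∷ mid ++ kₗ ∷ []) →
        (stern n m ≡ cont (k₀ ∷ mid ++ kₗ ∷ []))
      × (stern n (2 ^ n ∸ m) ≡ cont (mid ++ kₗ ∷ []))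
      × (stern n (suc m) ≡ cont (k₀ ∷ mid))
      × (stern n (2 ^ n ∸ suc m) ≡ cont mid))
    ×
    (∀ (n m : ℕ) → m < 2 ^ n →
      ∀ (k₀ : ℕ) →
      binWord n m ≡ runs true (k₀ ∷ []) →
        (n ≡ k₀) × (m ≡ 2 ^ n ∸ 1)
      × (stern n m ≡ n) × (stern n (2 ^ n ∸ m) ≡ 1)
      × (stern n (suc m) ≡ 1) × (stern n (2 ^ n ∸ suc m) ≡ 0))
theorem4p4 =
  (λ n m lt k₀ mid kₗ odd _ w →
    let pairs = stern-continuants n m lt k₀ (mid ∷ʳ kₗ) w (alternate-odd-∷ʳ true mid kₗ odd)
        direct = trans (proj₁ pairs) (contPair-reverse-∷ʳ (k₀ ∷ mid) kₗ)
        complement = trans (proj₂ pairs) (contPair-reverse-∷ʳ mid kₗ)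
    in cong proj₁ direct , cong proj₁ complement , cong proj₂ direct , cong proj₂ complement)
  ,
  (λ n m lt k₀ w →
    let ones = trans w (++-identityʳ (replicate k₀ true))
        n≡k₀ = trans (sym (length-binWord n m)) (trans (cong length ones) (length-replicate k₀))
        pairs = stern-continuants n m lt k₀ [] w refl
    in n≡k₀ , binWord≡replicate-true⇒≡2ⁿ∸1 n m lt (trans ones (cong (λ k → replicate k true) (sym n≡k₀)))
       , trans (cong proj₁ (proj₁ pairs)) (sym n≡k₀) , cong proj₁ (proj₂ pairs)
       , cong proj₂ (proj₁ pairs) , cong proj₂ (proj₂ pairs))
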